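{- Let $n,k$ be positive integers and let $u,v$ be vertices of the Kneser graph $K(2n+k,n)$. Then: (i) if $|u\cap v|<\left(\left\lceil\frac{n-1}{2k}\right\rceil-1\right)k+1$, then $\mathit{dist}(u,v)$ is odd; (ii) if $|u\cap v|>\left(\left\lceil\frac{n-1}{2k}\right\rceil-1\right)k+1+H(n,k)$, then $\mathit{dist}(u,v)$ is even, where $$H(n,k)=\begin{cases}\max\{(n\bmod k)+k-2,\,0\}, & \text{if } 0\le n\bmod k\le 1,\\ (n\bmod k)-2, & \text{if } 2\le n\bmod k\le k-1.\end{cases}$$
   Context: For positive integers $n,k$, the Kneser graph $K(2n+k,n)$ has as vertex set all $n$-element subsets of $\{1,\ldots,2n+k\}$, two vertices $u,v$ being adjacent iff $u\cap v=\emptyset$. $\mathit{dist}(u,v)$ is the length (number of edges) of a shortest path between $u$ and $v$. -}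

module Defs where

open import Data.Nat using (ℕ; zero; suc; _+_; _*_; _∸_; _≤_; NonZero; _≤ᵇ_)
open import Data.Nat.DivMod using (_/_; _%_)
open import Data.Nat.Properties using (m*n≢0)
open import Data.Integer as ℤ using (ℤ; +_)
open import Data.Bool using (if_then_else_)
open import Data.Fin.Subset using (Subset; ∣_∣; _∩_; Empty)
open import Data.Product using (_×_; ∃-syntax)
open import Relation.Binary.PropositionalEquality using (_≡_)

-- Vertices of the Kneser graph K(N, n): subsets of Fin N with exactly n elements.
-- Adjacency: disjointness (empty intersection).
Adjacent : ∀ {N} → Subset N → Subset N → Set
Adjacent u w = Empty (u ∩ w)

-- Walk N n u v ℓ : a walk of length ℓ (number of edges) in K(N, n) from u to v;
-- every vertex after the first is an n-subset (u is an n-subset by hypothesis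
-- wherever walks are used).
data Walk (N n : ℕ) : Subset N → Subset N → ℕ → Set where
  here : ∀ {u} → Walk N n u u 0
  step : ∀ {u w v ℓ} → ∣ w ∣ ≡ n → Adjacent u w → Walk N n w v ℓ →
         Walk N n u v (suc ℓ)

IsDist : (N n : ℕ) → Subset N → Subset N → ℕ → Set
IsDist N n u v d = Walk N n u v d × (∀ m → Walk N n u v m → d ≤ m)

Odd : ℕ → Set
Odd d = ∃[ m ] d ≡ suc (2 * m)

Even : ℕ → Set
Even d = ∃[ m ] d ≡ 2 * m

⌈_/_⌉ : ℕ → (b : ℕ) → .{{NonZero b}} → ℕ
⌈ a / b ⌉ = (a + b ∸ 1) / b

-- (⌈(n-1)/(2k)⌉ - 1)·k + 1, computed in ℤ (can be ≤ 0 when n = 1)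
threshold : (n k : ℕ) → .{{NonZero k}} → ℤ
threshold n k =
  ((+ (⌈_/_⌉ (n ∸ 1) (2 * k) {{m*n≢0 2 k}})) ℤ.- + 1) ℤ.* + k ℤ.+ + 1

-- H(n,k): if n mod k ≤ 1 then max{(n mod k)+k-2, 0} else (n mod k) - 2
-- (truncated subtraction ∸ realises max{·,0}; in the second branch n mod k ≥ 2).
H : (n k : ℕ) → .{{NonZero k}} → ℕ
H n k = if (n % k) ≤ᵇ 1 then (n % k + k) ∸ 2 else (n % k) ∸ 2

module Submission where

-- Let a, v be n-sets with t = |a ∩ v|. The neighbours of a are the n-subsets of the complement of a,
-- which has n + k elements, n − t of them in v; so they meet v in every size from max(0, n − k − t) to n − t.
-- Iterating, with s = |u ∩ v| there is a walk of length 2j from u to v iff n ≤ s + jk, and one of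
-- length 2j + 1 iff s ≤ jk, so dist(u,v) = min(2⌈(n − s)/k⌉, 2⌈s/k⌉ + 1). Below the threshold of (i)
-- every even walk is longer than 2⌈s/k⌉ + 1; above the threshold of (ii), where H(n,k) absorbs the
-- residue n mod k, every odd walk is longer than 2⌈(n − s)/k⌉.

open import Data.Nat using (ℕ)

module Subsets where

  open import Data.Nat using (zero; suc; _+_; _∸_; _≤_; z≤n; s≤s)
  open import Data.Nat.Properties using (+-suc; m≤n⇒m≤1+n; m+n∸n≡m; suc-injective; <⇒≢)
  open import Data.Vec using ([]; _∷_; here; there)
  open import Data.Fin using (zero; suc)
  open import Data.Fin.Subset using (Subset; inside; outside; _∩_; ∁; ∣_∣; Empty)
  open import Data.Fin.Subset.Properties using (drop-∷-Empty; ∣p∩q∣≤∣p∣; ∣p∩q∣≤∣q∣)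
  open import Data.Product using (_×_; _,_; ∃-syntax)
  open import Relation.Nullary using (contradiction)
  open import Relation.Binary.PropositionalEquality using (_≡_; refl; sym; trans; cong)

  Empty-outside∷ : ∀ {N} {p : Subset N} → Empty p → Empty (outside ∷ p)
  Empty-outside∷ e (suc x , there x∈p) = e (x , x∈p)

  ∣p∩r∣+∣q∩r∣≤∣r∣ : ∀ {N} (p q r : Subset N) → Empty (p ∩ q) → ∣ p ∩ r ∣ + ∣ q ∩ r ∣ ≤ ∣ r ∣
  ∣p∩r∣+∣q∩r∣≤∣r∣ []            []            []            _ = z≤n
  ∣p∩r∣+∣q∩r∣≤∣r∣ (inside  ∷ p) (inside  ∷ q) _             e = contradiction (zero , here) e
  ∣p∩r∣+∣q∩r∣≤∣r∣ (inside  ∷ p) (outside ∷ q) (inside  ∷ r) e =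
    s≤s (∣p∩r∣+∣q∩r∣≤∣r∣ p q r (drop-∷-Empty e))
  ∣p∩r∣+∣q∩r∣≤∣r∣ (outside ∷ p) (inside  ∷ q) (inside  ∷ r) e
    rewrite +-suc ∣ p ∩ r ∣ ∣ q ∩ r ∣ = s≤s (∣p∩r∣+∣q∩r∣≤∣r∣ p q r (drop-∷-Empty e))
  ∣p∩r∣+∣q∩r∣≤∣r∣ (outside ∷ p) (outside ∷ q) (inside  ∷ r) e =
    m≤n⇒m≤1+n (∣p∩r∣+∣q∩r∣≤∣r∣ p q r (drop-∷-Empty e))
  ∣p∩r∣+∣q∩r∣≤∣r∣ (inside  ∷ p) (outside ∷ q) (outside ∷ r) e = ∣p∩r∣+∣q∩r∣≤∣r∣ p q r (drop-∷-Empty e)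
  ∣p∩r∣+∣q∩r∣≤∣r∣ (outside ∷ p) (inside  ∷ q) (outside ∷ r) e = ∣p∩r∣+∣q∩r∣≤∣r∣ p q r (drop-∷-Empty e)
  ∣p∩r∣+∣q∩r∣≤∣r∣ (outside ∷ p) (outside ∷ q) (outside ∷ r) e = ∣p∩r∣+∣q∩r∣≤∣r∣ p q r (drop-∷-Empty e)

  ∣p∣+∣q∣+∣r∣≤N+∣p∩r∣+∣q∩r∣ : ∀ {N} (p q r : Subset N) → Empty (p ∩ q) →
                             ∣ p ∣ + ∣ q ∣ + ∣ r ∣ ≤ N + ∣ p ∩ r ∣ + ∣ q ∩ r ∣
  ∣p∣+∣q∣+∣r∣≤N+∣p∩r∣+∣q∩r∣ []            []            []            _ = z≤n
  ∣p∣+∣q∣+∣r∣≤N+∣p∩r∣+∣q∩r∣ (inside  ∷ p) (inside  ∷ q) _             e = contradiction (zero , here) e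
  ∣p∣+∣q∣+∣r∣≤N+∣p∩r∣+∣q∩r∣ {suc N} (inside  ∷ p) (outside ∷ q) (inside  ∷ r) e
    rewrite +-suc (∣ p ∣ + ∣ q ∣) ∣ r ∣ | +-suc N ∣ p ∩ r ∣ =
    s≤s (s≤s (∣p∣+∣q∣+∣r∣≤N+∣p∩r∣+∣q∩r∣ p q r (drop-∷-Empty e)))
  ∣p∣+∣q∣+∣r∣≤N+∣p∩r∣+∣q∩r∣ {suc N} (outside ∷ p) (inside  ∷ q) (inside  ∷ r) e
    rewrite +-suc ∣ p ∣ ∣ q ∣ | +-suc (∣ p ∣ + ∣ q ∣) ∣ r ∣ | +-suc (N + ∣ p ∩ r ∣) ∣ q ∩ r ∣ =
    s≤s (s≤s (∣p∣+∣q∣+∣r∣≤N+∣p∩r∣+∣q∩r∣ p q r (drop-∷-Empty e)))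
  ∣p∣+∣q∣+∣r∣≤N+∣p∩r∣+∣q∩r∣ {suc N} (outside ∷ p) (outside ∷ q) (inside  ∷ r) e
    rewrite +-suc (∣ p ∣ + ∣ q ∣) ∣ r ∣ = s≤s (∣p∣+∣q∣+∣r∣≤N+∣p∩r∣+∣q∩r∣ p q r (drop-∷-Empty e))
  ∣p∣+∣q∣+∣r∣≤N+∣p∩r∣+∣q∩r∣ {suc N} (inside  ∷ p) (outside ∷ q) (outside ∷ r) e =
    s≤s (∣p∣+∣q∣+∣r∣≤N+∣p∩r∣+∣q∩r∣ p q r (drop-∷-Empty e))
  ∣p∣+∣q∣+∣r∣≤N+∣p∩r∣+∣q∩r∣ {suc N} (outside ∷ p) (inside  ∷ q) (outside ∷ r) e
    rewrite +-suc ∣ p ∣ ∣ q ∣ = s≤s (∣p∣+∣q∣+∣r∣≤N+∣p∩r∣+∣q∩r∣ p q r (drop-∷-Empty e))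
  ∣p∣+∣q∣+∣r∣≤N+∣p∩r∣+∣q∩r∣ {suc N} (outside ∷ p) (outside ∷ q) (outside ∷ r) e =
    m≤n⇒m≤1+n (∣p∣+∣q∣+∣r∣≤N+∣p∩r∣+∣q∩r∣ p q r (drop-∷-Empty e))

  ∣∁p∩q∣+∣p∩q∣≡∣q∣ : ∀ {N} (p q : Subset N) → ∣ ∁ p ∩ q ∣ + ∣ p ∩ q ∣ ≡ ∣ q ∣
  ∣∁p∩q∣+∣p∩q∣≡∣q∣ []            []            = refl
  ∣∁p∩q∣+∣p∩q∣≡∣q∣ (inside  ∷ p) (inside  ∷ q) = trans (+-suc _ _) (cong suc (∣∁p∩q∣+∣p∩q∣≡∣q∣ p q))
  ∣∁p∩q∣+∣p∩q∣≡∣q∣ (inside  ∷ p) (outside ∷ q) = ∣∁p∩q∣+∣p∩q∣≡∣q∣ p q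
  ∣∁p∩q∣+∣p∩q∣≡∣q∣ (outside ∷ p) (inside  ∷ q) = cong suc (∣∁p∩q∣+∣p∩q∣≡∣q∣ p q)
  ∣∁p∩q∣+∣p∩q∣≡∣q∣ (outside ∷ p) (outside ∷ q) = ∣∁p∩q∣+∣p∩q∣≡∣q∣ p q

  ∣∁p∩q∣≡∣q∣∸∣p∩q∣ : ∀ {N} (p q : Subset N) → ∣ ∁ p ∩ q ∣ ≡ ∣ q ∣ ∸ ∣ p ∩ q ∣
  ∣∁p∩q∣≡∣q∣∸∣p∩q∣ p q =
    trans (sym (m+n∸n≡m _ ∣ p ∩ q ∣)) (cong (_∸ ∣ p ∩ q ∣) (∣∁p∩q∣+∣p∩q∣≡∣q∣ p q))

  ∣∁p∩∁q∣+∣p∣+∣q∣≡N+∣p∩q∣ : ∀ {N} (p q : Subset N) → ∣ ∁ p ∩ ∁ q ∣ + ∣ p ∣ + ∣ q ∣ ≡ N + ∣ p ∩ q ∣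
  ∣∁p∩∁q∣+∣p∣+∣q∣≡N+∣p∩q∣ []            []            = refl
  ∣∁p∩∁q∣+∣p∣+∣q∣≡N+∣p∩q∣ {suc N} (inside  ∷ p) (inside  ∷ q)
    rewrite +-suc ∣ ∁ p ∩ ∁ q ∣ ∣ p ∣ | +-suc (∣ ∁ p ∩ ∁ q ∣ + ∣ p ∣) ∣ q ∣ | +-suc N ∣ p ∩ q ∣ =
    cong (2 +_) (∣∁p∩∁q∣+∣p∣+∣q∣≡N+∣p∩q∣ p q)
  ∣∁p∩∁q∣+∣p∣+∣q∣≡N+∣p∩q∣ (inside  ∷ p) (outside ∷ q)
    rewrite +-suc ∣ ∁ p ∩ ∁ q ∣ ∣ p ∣ = cong suc (∣∁p∩∁q∣+∣p∣+∣q∣≡N+∣p∩q∣ p q)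
  ∣∁p∩∁q∣+∣p∣+∣q∣≡N+∣p∩q∣ (outside ∷ p) (inside  ∷ q)
    rewrite +-suc (∣ ∁ p ∩ ∁ q ∣ + ∣ p ∣) ∣ q ∣ = cong suc (∣∁p∩∁q∣+∣p∣+∣q∣≡N+∣p∩q∣ p q)
  ∣∁p∩∁q∣+∣p∣+∣q∣≡N+∣p∩q∣ (outside ∷ p) (outside ∷ q) = cong suc (∣∁p∩∁q∣+∣p∣+∣q∣≡N+∣p∩q∣ p q)

  ∣p∩q∣≡∣p∣≡∣q∣⇒p≡q : ∀ {N} (p q : Subset N) → ∣ p ∩ q ∣ ≡ ∣ p ∣ → ∣ p ∩ q ∣ ≡ ∣ q ∣ → p ≡ q
  ∣p∩q∣≡∣p∣≡∣q∣⇒p≡q []            []            _  _  = refl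
  ∣p∩q∣≡∣p∣≡∣q∣⇒p≡q (inside  ∷ p) (inside  ∷ q) e₁ e₂ =
    cong (inside ∷_) (∣p∩q∣≡∣p∣≡∣q∣⇒p≡q p q (suc-injective e₁) (suc-injective e₂))
  ∣p∩q∣≡∣p∣≡∣q∣⇒p≡q (inside  ∷ p) (outside ∷ q) e₁ _  = contradiction e₁ (<⇒≢ (s≤s (∣p∩q∣≤∣p∣ p q)))
  ∣p∩q∣≡∣p∣≡∣q∣⇒p≡q (outside ∷ p) (inside  ∷ q) _  e₂ = contradiction e₂ (<⇒≢ (s≤s (∣p∩q∣≤∣q∣ p q)))
  ∣p∩q∣≡∣p∣≡∣q∣⇒p≡q (outside ∷ p) (outside ∷ q) e₁ e₂ = cong (outside ∷_) (∣p∩q∣≡∣p∣≡∣q∣⇒p≡q p q e₁ e₂)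

  ∃-disjoint-with-trace : ∀ {N} (a v : Subset N) {p q} → p ≤ ∣ ∁ a ∩ v ∣ → q ≤ ∣ ∁ a ∩ ∁ v ∣ →
                          ∃[ w ] Empty (a ∩ w) × ∣ w ∣ ≡ p + q × ∣ w ∩ v ∣ ≡ p
  ∃-disjoint-with-trace [] [] z≤n z≤n = [] , (λ ()) , refl , refl
  ∃-disjoint-with-trace (inside ∷ a) (_ ∷ v) hp hq
    with w , a∩w=∅ , ∣w∣ , ∣w∩v∣ ← ∃-disjoint-with-trace a v hp hq =
    outside ∷ w , Empty-outside∷ a∩w=∅ , ∣w∣ , ∣w∩v∣
  ∃-disjoint-with-trace (outside ∷ a) (inside ∷ v) {zero} hp hq
    with w , a∩w=∅ , ∣w∣ , ∣w∩v∣ ← ∃-disjoint-with-trace a v z≤n hq =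
    outside ∷ w , Empty-outside∷ a∩w=∅ , ∣w∣ , ∣w∩v∣
  ∃-disjoint-with-trace (outside ∷ a) (inside ∷ v) {suc p} (s≤s hp) hq
    with w , a∩w=∅ , ∣w∣ , ∣w∩v∣ ← ∃-disjoint-with-trace a v hp hq =
    inside ∷ w , Empty-outside∷ a∩w=∅ , cong suc ∣w∣ , cong suc ∣w∩v∣
  ∃-disjoint-with-trace (outside ∷ a) (outside ∷ v) {q = zero} hp hq
    with w , a∩w=∅ , ∣w∣ , ∣w∩v∣ ← ∃-disjoint-with-trace a v hp z≤n =
    outside ∷ w , Empty-outside∷ a∩w=∅ , ∣w∣ , ∣w∩v∣
  ∃-disjoint-with-trace (outside ∷ a) (outside ∷ v) {p} {suc q} hp (s≤s hq)
    with w , a∩w=∅ , ∣w∣ , ∣w∩v∣ ← ∃-disjoint-with-trace a v hp hq =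
    inside ∷ w , Empty-outside∷ a∩w=∅ , trans (cong suc ∣w∣) (sym (+-suc p q)) , ∣w∩v∣

module Arithmetic where

  open import Defs using (Even; Odd; ⌈_/_⌉; H; threshold)
  open import Data.Nat
  open import Data.Nat.Properties
  open import Data.Nat.DivMod using (_/_; _%_; m≡m%n+[m/n]*n; m%n<n; m<n*o⇒m/o<n)
  open import Data.Nat.Tactic.RingSolver using (solve-∀)
  open import Data.Integer as ℤ using (ℤ; +_)
  import Data.Integer.Properties as ℤ
  import Data.Integer.Tactic.RingSolver as ℤ-Solver
  open import Data.Bool using (if_then_else_)
  open import Data.Product using (_,_)
  open import Data.Sum using (_⊎_; inj₁; inj₂)
  open import Relation.Nullary using (yes; no; contradiction)
  open import Relation.Binary.PropositionalEquality

  m≤m∸n+n : ∀ m n → m ≤ m ∸ n + n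
  m≤m∸n+n m n = ≤-trans (m≤n+m∸n m n) (≤-reflexive (+-comm n (m ∸ n)))

  m≤⌈m/n⌉*n : ∀ m n .{{_ : NonZero n}} → m ≤ ⌈ m / n ⌉ * n
  m≤⌈m/n⌉*n m n@(suc d) = +-cancelʳ-≤ d m (x / n * n) (begin
    m + d               ≡⟨ cong (_∸ 1) (+-suc m d) ⟨
    x                   ≡⟨ m≡m%n+[m/n]*n x n ⟩
    x % n + x / n * n   ≤⟨ +-monoˡ-≤ (x / n * n) (s≤s⁻¹ (m%n<n x n)) ⟩
    d + x / n * n       ≡⟨ +-comm d (x / n * n) ⟩
    x / n * n + d       ∎)
    where
    open ≤-Reasoning
    x : ℕ
    x = m + n ∸ 1

  m≤o*n⇒⌈m/n⌉≤o : ∀ m n o .{{_ : NonZero n}} → m ≤ o * n → ⌈ m / n ⌉ ≤ o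
  m≤o*n⇒⌈m/n⌉≤o m n@(suc d) o m≤on = s≤s⁻¹ (m<n*o⇒m/o<n (begin-strict
    m + n ∸ 1    ≡⟨ cong (_∸ 1) (+-suc m d) ⟩
    m + d        ≤⟨ +-monoˡ-≤ d m≤on ⟩
    o * n + d    <⟨ +-monoʳ-< (o * n) (n<1+n d) ⟩
    o * n + n    ≡⟨ +-comm (o * n) n ⟩
    suc o * n    ∎))
    where open ≤-Reasoning

  even⊎odd : ∀ m → Even m ⊎ Odd m
  even⊎odd zero = inj₁ (0 , refl)
  even⊎odd (suc m) with even⊎odd m
  ... | inj₁ (i , refl) = inj₂ (i , refl)
  ... | inj₂ (i , refl) = inj₁ (suc i , cong suc (sym (+-suc i (i + 0))))

  n%k≤H+2 : ∀ n k .{{_ : NonZero k}} → n % k ≤ H n k + 2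
  n%k≤H+2 n k = bound (n % k)
    where
    bound : ∀ r → r ≤ (if r ≤ᵇ 1 then r + k ∸ 2 else r ∸ 2) + 2
    bound zero                = z≤n
    bound (suc zero)          = ≤-trans (n≤1+n 1) (m≤n+m 2 _)
    bound (suc (suc r))       = ≤-reflexive (+-comm 2 r)

  n%k≤1⇒n%k+k≤H+2 : ∀ n k .{{_ : NonZero k}} → n % k ≤ 1 → n % k + k ≤ H n k + 2
  n%k≤1⇒n%k+k≤H+2 n k = bound (n % k)
    where
    bound : ∀ r → r ≤ 1 → r + k ≤ (if r ≤ᵇ 1 then r + k ∸ 2 else r ∸ 2) + 2
    bound zero          _ = m≤m∸n+n k 2
    bound (suc zero)    _ = m≤m∸n+n (suc k) 2
    bound (suc (suc r)) (s≤s ())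

  -- Write n = n % k + q k. If q ≤ m the residue alone is within H + 2; otherwise the hypothesis
  -- leaves n % k + (q − 1 − m) k ≤ 1, so either q = 1 + m with n % k ≤ 1, or k = 1.
  n≤[1+m]k+1⇒n≤mk+H+2 : ∀ n k m .{{_ : NonZero k}} → n ≤ suc m * k + 1 → n ≤ m * k + (H n k + 2)
  n≤[1+m]k+1⇒n≤mk+H+2 n k m n≤ with n / k ≤? m
  ... | yes q≤m = begin
    n                  ≡⟨ m≡m%n+[m/n]*n n k ⟩
    n % k + n / k * k  ≤⟨ +-mono-≤ (n%k≤H+2 n k) (*-monoˡ-≤ k q≤m) ⟩
    H n k + 2 + m * k  ≡⟨ +-comm (H n k + 2) (m * k) ⟩
    m * k + (H n k + 2) ∎
    where open ≤-Reasoning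
  ... | no q≰m = beyond (n / k ∸ suc m) (begin-equality
      n                        ≡⟨ m≡m%n+[m/n]*n n k ⟩
      n % k + n / k * k        ≡⟨ cong (λ q → n % k + q * k) (m+[n∸m]≡n (≰⇒> q≰m)) ⟨
      n % k + (suc m + e) * k  ≡⟨ rearrange (n % k) (suc m) e k ⟩
      n % k + e * k + suc m * k ∎)
    where
    open ≤-Reasoning
    e : ℕ
    e = n / k ∸ suc m
    rearrange : ∀ r m e k → r + (m + e) * k ≡ r + e * k + m * k
    rearrange = solve-∀
    r+ek≤1 : ∀ {e} → n ≡ n % k + e * k + suc m * k → n % k + e * k ≤ 1
    r+ek≤1 {e} n≡ = +-cancelʳ-≤ (suc m * k) (n % k + e * k) 1 (begin
      n % k + e * k + suc m * k  ≡⟨ n≡ ⟨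
      n                          ≤⟨ n≤ ⟩
      suc m * k + 1              ≡⟨ +-comm (suc m * k) 1 ⟩
      1 + suc m * k              ∎)
    beyond : ∀ e → n ≡ n % k + e * k + suc m * k → n ≤ m * k + (H n k + 2)
    beyond zero n≡ = begin
      n                          ≡⟨ n≡ ⟩
      n % k + 0 + (k + m * k)    ≡⟨ rearrange′ (n % k) k (m * k) ⟩
      n % k + k + m * k          ≤⟨ +-monoˡ-≤ (m * k) (n%k≤1⇒n%k+k≤H+2 n k r≤1) ⟩
      H n k + 2 + m * k          ≡⟨ +-comm (H n k + 2) (m * k) ⟩
      m * k + (H n k + 2)        ∎
      where
      r≤1 : n % k ≤ 1
      r≤1 = ≤-trans (m≤m+n (n % k) 0) (r+ek≤1 {0} n≡)
      rearrange′ : ∀ r k x → r + 0 + (k + x) ≡ r + k + x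
      rearrange′ = solve-∀
    beyond (suc e) n≡ = begin
      n                          ≤⟨ n≤ ⟩
      k + m * k + 1              ≡⟨ rearrange′ k (m * k) ⟩
      m * k + (k + 1)            ≤⟨ +-monoʳ-≤ (m * k) (+-monoˡ-≤ 1 k≤1) ⟩
      m * k + 2                  ≤⟨ +-monoʳ-≤ (m * k) (m≤n+m 2 (H n k)) ⟩
      m * k + (H n k + 2)        ∎
      where
      k≤1 : k ≤ 1
      k≤1 = ≤-trans (≤-trans (m≤m+n k (e * k)) (m≤n+m (suc e * k) (n % k))) (r+ek≤1 {suc e} n≡)
      rearrange′ : ∀ k x → k + x + 1 ≡ x + (k + 1)
      rearrange′ = solve-∀

  n≤s+ik⇒s+k≤ik : ∀ {n k s} c i → c * (2 * k) < n ∸ 1 → s ≤ c * k → n ≤ s + i * k → s + k ≤ i * k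
  n≤s+ik⇒s+k≤ik {n} {k} {s} c i c2k<n∸1 s≤ck n≤s+ik with suc c ≤? i
  ... | yes c<i = begin
    s + k      ≤⟨ +-monoˡ-≤ k s≤ck ⟩
    c * k + k  ≡⟨ +-comm (c * k) k ⟩
    suc c * k  ≤⟨ *-monoˡ-≤ k c<i ⟩
    i * k      ∎
    where open ≤-Reasoning
  ... | no c≮i = contradiction (begin-strict
    n              ≤⟨ n≤s+ik ⟩
    s + i * k      ≤⟨ +-mono-≤ s≤ck (*-monoˡ-≤ k (≮⇒≥ c≮i)) ⟩
    c * k + c * k  ≡⟨ double c k ⟩
    c * (2 * k)    <⟨ c2k<n∸1 ⟩
    n ∸ 1          ≤⟨ m∸n≤m n 1 ⟩
    n              ∎) (<-irrefl refl)
    where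
    open ≤-Reasoning
    double : ∀ c k → c * k + c * k ≡ c * (2 * k)
    double = solve-∀

  s≤ik⇒n≤s+ik : ∀ n k c s i .{{_ : NonZero k}} → n ∸ 1 ≤ suc c * (2 * k) → c * k + 1 + H n k < s →
                s ≤ i * k → n ≤ s + i * k
  s≤ik⇒n≤s+ik n k c s i n∸1≤ s> s≤ik with suc c ≤? i
  ... | yes c<i = begin
    n                                  ≤⟨ n≤[1+m]k+1⇒n≤mk+H+2 n k (suc (2 * c)) n≤ ⟩
    suc (2 * c) * k + (H n k + 2)      ≡⟨ rearrange c k (H n k) ⟩
    suc (c * k + 1 + H n k) + suc c * k ≤⟨ +-mono-≤ s> (*-monoˡ-≤ k c<i) ⟩
    s + i * k                          ∎
    where
    open ≤-Reasoning
    rearrange : ∀ c k h → suc (2 * c) * k + (h + 2) ≡ suc (c * k + 1 + h) + suc c * k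
    rearrange = solve-∀
    n≤ : n ≤ suc (suc (2 * c)) * k + 1
    n≤ = begin
      n                          ≤⟨ m≤m∸n+n n 1 ⟩
      n ∸ 1 + 1                  ≤⟨ +-monoˡ-≤ 1 n∸1≤ ⟩
      suc c * (2 * k) + 1        ≡⟨ cong (_+ 1) (rearrange′ c k) ⟩
      suc (suc (2 * c)) * k + 1  ∎
      where rearrange′ : ∀ c k → suc c * (2 * k) ≡ suc (suc (2 * c)) * k
            rearrange′ = solve-∀
  ... | no c≮i = contradiction (begin-strict
    s                  ≤⟨ s≤ik ⟩
    i * k              ≤⟨ *-monoˡ-≤ k (≮⇒≥ c≮i) ⟩
    c * k              ≤⟨ m≤m+n (c * k) (1 + H n k) ⟩
    c * k + (1 + H n k) ≡⟨ +-assoc (c * k) 1 (H n k) ⟨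
    c * k + 1 + H n k  <⟨ s> ⟩
    s                  ∎) (<-irrefl refl)
    where open ≤-Reasoning

  H-one : ∀ k .{{_ : NonZero k}} → H 1 k ≡ k ∸ 1
  H-one (suc zero)    = refl
  H-one (suc (suc k)) = refl

  module _ (n k : ℕ) .{{_ : NonZero k}} where

    private
      instance
        2k≢0 : NonZero (2 * k)
        2k≢0 = m*n≢0 2 k

      c : ℕ
      c = ⌈ n ∸ 1 / 2 * k ⌉

      threshold-at : ℕ → ℕ → ℤ
      threshold-at x y = (+ x ℤ.- + 1) ℤ.* + y ℤ.+ + 1

    threshold-suc : ∀ {c′} → c ≡ suc c′ → threshold n k ≡ + (c′ * k + 1)
    threshold-suc {c′} c≡ =
      trans (cong (λ c → threshold-at c k) c≡) (cong (ℤ._+ + 1) (sym (ℤ.pos-* c′ k)))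

    threshold-zero : c ≡ 0 → threshold n k ℤ.+ + (k ∸ 1) ≡ + 0
    threshold-zero c≡ = trans (cong (λ c → threshold-at c k ℤ.+ + (k ∸ 1)) c≡) (cancel k)
      where
      cancel : ∀ k .{{_ : NonZero k}} → threshold-at 0 k ℤ.+ + (k ∸ 1) ≡ + 0
      cancel (suc k′) = identity (+ k′)
        where
        identity : ∀ x → (+ 0 ℤ.- + 1) ℤ.* (+ 1 ℤ.+ x) ℤ.+ + 1 ℤ.+ x ≡ + 0
        identity = ℤ-Solver.solve-∀

    odd-regime : ∀ s → + s ℤ.< threshold n k → ∀ i → n ≤ s + i * k → s + k ≤ i * k
    odd-regime s s<T = by-ceiling c refl
      where
      by-ceiling : ∀ c′ → c ≡ c′ → ∀ i → n ≤ s + i * k → s + k ≤ i * k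
      by-ceiling zero c≡0 = contradiction (begin
        threshold n k                   ≤⟨ ℤ.i≤i+j (threshold n k) (+ (k ∸ 1)) ⟩
        threshold n k ℤ.+ + (k ∸ 1)     ≡⟨ threshold-zero c≡0 ⟩
        + 0                             ≤⟨ ℤ.+≤+ z≤n ⟩
        + s                             ∎) (ℤ.<⇒≱ s<T)
        where open ℤ.≤-Reasoning
      by-ceiling (suc c′) c≡ i = n≤s+ik⇒s+k≤ik c′ i c′2k<n∸1 s≤c′k
        where
        c′2k<n∸1 : c′ * (2 * k) < n ∸ 1
        c′2k<n∸1 = ≰⇒> (λ n∸1≤c′2k →
          1+n≰n (subst (_≤ c′) c≡ (m≤o*n⇒⌈m/n⌉≤o (n ∸ 1) (2 * k) c′ n∸1≤c′2k)))
        s≤c′k : s ≤ c′ * k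
        s≤c′k = m<1+n⇒m≤n (subst (s <_) (+-comm (c′ * k) 1)
                  (ℤ.drop‿+<+ (subst (+ s ℤ.<_) (threshold-suc c≡) s<T)))

    even-regime : .{{_ : NonZero n}} → ∀ s → threshold n k ℤ.+ + H n k ℤ.< + s → ∀ i → s ≤ i * k → n ≤ s + i * k
    even-regime s T+H<s = by-ceiling c refl
      where
      n∸1≤c2k : n ∸ 1 ≤ c * (2 * k)
      n∸1≤c2k = m≤⌈m/n⌉*n (n ∸ 1) (2 * k)
      by-ceiling : ∀ c′ → c ≡ c′ → ∀ i → s ≤ i * k → n ≤ s + i * k
      by-ceiling zero c≡0 i _ = ≤-trans (≤-trans n≤1 0<s) (m≤m+n s (i * k))
        where
        n≤1 : n ≤ 1
        n≤1 = ≤-trans (m≤m∸n+n n 1) (+-monoˡ-≤ 1 (subst (λ c → n ∸ 1 ≤ c * (2 * k)) c≡0 n∸1≤c2k))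
        T+H≡0 : threshold n k ℤ.+ + H n k ≡ + 0
        T+H≡0 = begin
          threshold n k ℤ.+ + H n k      ≡⟨ cong (λ m → threshold n k ℤ.+ + H m k) (≤-antisym n≤1 (>-nonZero⁻¹ n)) ⟩
          threshold n k ℤ.+ + H 1 k      ≡⟨ cong (λ h → threshold n k ℤ.+ + h) (H-one k) ⟩
          threshold n k ℤ.+ + (k ∸ 1)    ≡⟨ threshold-zero c≡0 ⟩
          + 0                            ∎
          where open ≡-Reasoning
        0<s : 0 < s
        0<s = ℤ.drop‿+<+ (subst (ℤ._< + s) T+H≡0 T+H<s)
      by-ceiling (suc c′) c≡ i =
        s≤ik⇒n≤s+ik n k c′ s i (subst (λ c → n ∸ 1 ≤ c * (2 * k)) c≡ n∸1≤c2k)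
          (ℤ.drop‿+<+ (subst (λ t → t ℤ.+ + H n k ℤ.< + s) (threshold-suc c≡) T+H<s))

module KneserGraph (n k : ℕ) where

  open import Defs using (Adjacent; Walk; here; step; IsDist; ⌈_/_⌉)
  open import Data.Nat
  open import Data.Nat.Properties
  open import Data.Nat.Tactic.RingSolver using (solve-∀)
  open import Data.Fin.Subset using (Subset; _∩_; ∁; ∣_∣)
  open import Data.Fin.Subset.Properties using (∣p∩q∣≤∣p∣; ∩-idem)
  open import Data.Product using (_×_; _,_; ∃-syntax)
  open import Data.Sum using (inj₁; inj₂)
  open import Relation.Nullary using (contradiction)
  open import Relation.Binary.PropositionalEquality
  open Subsets
  open Arithmetic

  private
    N : ℕ
    N = 2 * n + k

  ∣∁a∩∁v∣≡k+∣a∩v∣ : ∀ (a v : Subset N) → ∣ a ∣ ≡ n → ∣ v ∣ ≡ n → ∣ ∁ a ∩ ∁ v ∣ ≡ k + ∣ a ∩ v ∣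
  ∣∁a∩∁v∣≡k+∣a∩v∣ a v ∣a∣ ∣v∣ = +-cancelʳ-≡ (n + n) _ _ (begin
    ∣ ∁ a ∩ ∁ v ∣ + (n + n)          ≡⟨ +-assoc _ n n ⟨
    ∣ ∁ a ∩ ∁ v ∣ + n + n            ≡⟨ cong₂ (λ x y → ∣ ∁ a ∩ ∁ v ∣ + x + y) ∣a∣ ∣v∣ ⟨
    ∣ ∁ a ∩ ∁ v ∣ + ∣ a ∣ + ∣ v ∣    ≡⟨ ∣∁p∩∁q∣+∣p∣+∣q∣≡N+∣p∩q∣ a v ⟩
    N + ∣ a ∩ v ∣                   ≡⟨ rearrange n k (∣ a ∩ v ∣) ⟩
    k + ∣ a ∩ v ∣ + (n + n)          ∎)
    where
    open ≡-Reasoning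
    rearrange : ∀ n k t → 2 * n + k + t ≡ k + t + (n + n)
    rearrange = solve-∀

  neighbour-with-trace : ∀ {a v : Subset N} p → ∣ a ∣ ≡ n → ∣ v ∣ ≡ n →
                         p ≤ n ∸ ∣ a ∩ v ∣ → n ≤ p + (k + ∣ a ∩ v ∣) →
                         ∃[ w ] ∣ w ∣ ≡ n × Adjacent a w × ∣ w ∩ v ∣ ≡ p
  neighbour-with-trace {a} {v} p ∣a∣ ∣v∣ p≤n∸t n≤p+k+t
    with w , a∩w=∅ , ∣w∣ , ∣w∩v∣ ← ∃-disjoint-with-trace a v {p} {n ∸ p}
           (≤-trans p≤n∸t (≤-reflexive (sym (trans (∣∁p∩q∣≡∣q∣∸∣p∩q∣ a v) (cong (_∸ ∣ a ∩ v ∣) ∣v∣)))))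
           (≤-trans (m≤n+o⇒m∸n≤o n p n≤p+k+t) (≤-reflexive (sym (∣∁a∩∁v∣≡k+∣a∩v∣ a v ∣a∣ ∣v∣))))
    = w , trans ∣w∣ (m+[n∸m]≡n (≤-trans p≤n∸t (m∸n≤m n (∣ a ∩ v ∣)))) , a∩w=∅ , ∣w∩v∣

  mutual
    even-walk-bound : ∀ j {a v : Subset N} → ∣ a ∣ ≡ n → ∣ v ∣ ≡ n →
                      Walk N n a v (2 * j) → n ≤ ∣ a ∩ v ∣ + j * k
    even-walk-bound zero {a} ∣a∣ _ here = ≤-reflexive (begin
      n               ≡⟨ ∣a∣ ⟨
      ∣ a ∣           ≡⟨ cong ∣_∣ (∩-idem a) ⟨
      ∣ a ∩ a ∣       ≡⟨ +-identityʳ _ ⟨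
      ∣ a ∩ a ∣ + 0   ∎)
      where open ≡-Reasoning
    even-walk-bound (suc j) {a} {v} ∣a∣ ∣v∣ (step {w = w} ∣w∣ a∩w=∅ walk) =
      +-cancelˡ-≤ (n + n) n _ (begin
        n + n + n                       ≡⟨ cong₂ _+_ (cong₂ _+_ ∣a∣ ∣w∣) ∣v∣ ⟨
        ∣ a ∣ + ∣ w ∣ + ∣ v ∣           ≤⟨ ∣p∣+∣q∣+∣r∣≤N+∣p∩r∣+∣q∩r∣ a w v a∩w=∅ ⟩
        N + ∣ a ∩ v ∣ + ∣ w ∩ v ∣       ≤⟨ +-monoʳ-≤ (N + ∣ a ∩ v ∣) ∣w∩v∣≤jk ⟩
        N + ∣ a ∩ v ∣ + j * k           ≡⟨ rearrange n k (∣ a ∩ v ∣) (j * k) ⟩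
        n + n + (∣ a ∩ v ∣ + suc j * k) ∎)
      where
      open ≤-Reasoning
      ∣w∩v∣≤jk : ∣ w ∩ v ∣ ≤ j * k
      ∣w∩v∣≤jk = odd-walk-bound j ∣w∣ ∣v∣ (subst (Walk N n w v) (+-suc j (j + 0)) walk)
      rearrange : ∀ n k t m → 2 * n + k + t + m ≡ n + n + (t + (k + m))
      rearrange = solve-∀

    odd-walk-bound : ∀ j {a v : Subset N} → ∣ a ∣ ≡ n → ∣ v ∣ ≡ n →
                     Walk N n a v (suc (2 * j)) → ∣ a ∩ v ∣ ≤ j * k
    odd-walk-bound j {a} {v} ∣a∣ ∣v∣ (step {w = w} ∣w∣ a∩w=∅ walk) =
      +-cancelʳ-≤ ∣ w ∩ v ∣ _ _ (begin
        ∣ a ∩ v ∣ + ∣ w ∩ v ∣ ≤⟨ ∣p∩r∣+∣q∩r∣≤∣r∣ a w v a∩w=∅ ⟩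
        ∣ v ∣                 ≡⟨ ∣v∣ ⟩
        n                     ≤⟨ even-walk-bound j ∣w∣ ∣v∣ walk ⟩
        ∣ w ∩ v ∣ + j * k     ≡⟨ +-comm ∣ w ∩ v ∣ (j * k) ⟩
        j * k + ∣ w ∩ v ∣     ∎)
      where open ≤-Reasoning

  mutual
    even-walk : ∀ j {a v : Subset N} → ∣ a ∣ ≡ n → ∣ v ∣ ≡ n →
                n ≤ ∣ a ∩ v ∣ + j * k → Walk N n a v (2 * j)
    even-walk zero {a} {v} ∣a∣ ∣v∣ n≤t+0 =
      subst (λ x → Walk N n a x 0) (∣p∩q∣≡∣p∣≡∣q∣⇒p≡q a v (trans t≡n (sym ∣a∣)) (trans t≡n (sym ∣v∣))) here
      where
      t≡n : ∣ a ∩ v ∣ ≡ n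
      t≡n = ≤-antisym (≤-trans (∣p∩q∣≤∣p∣ a v) (≤-reflexive ∣a∣))
                      (≤-trans n≤t+0 (≤-reflexive (+-identityʳ _)))
    even-walk (suc j) {a} {v} ∣a∣ ∣v∣ n≤t+k+jk
      with w , ∣w∣ , a∩w=∅ , ∣w∩v∣ ← neighbour-with-trace (n ∸ (k + ∣ a ∩ v ∣)) ∣a∣ ∣v∣
             (∸-monoʳ-≤ n (m≤n+m (∣ a ∩ v ∣) k)) (m≤m∸n+n n (k + ∣ a ∩ v ∣))
      = subst (Walk N n a v) (cong suc (sym (+-suc j (j + 0))))
          (step ∣w∣ a∩w=∅ (odd-walk j ∣w∣ ∣v∣ (begin
            ∣ w ∩ v ∣              ≡⟨ ∣w∩v∣ ⟩
            n ∸ (k + ∣ a ∩ v ∣)    ≤⟨ m≤n+o⇒m∸n≤o n (k + ∣ a ∩ v ∣) n≤k+t+jk ⟩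
            j * k                  ∎)))
      where
      open ≤-Reasoning
      n≤k+t+jk : n ≤ k + ∣ a ∩ v ∣ + j * k
      n≤k+t+jk = ≤-trans n≤t+k+jk (≤-reflexive (rearrange (∣ a ∩ v ∣) k (j * k)))
        where rearrange : ∀ t k m → t + (k + m) ≡ k + t + m
              rearrange = solve-∀

    odd-walk : ∀ j {a v : Subset N} → ∣ a ∣ ≡ n → ∣ v ∣ ≡ n →
               ∣ a ∩ v ∣ ≤ j * k → Walk N n a v (suc (2 * j))
    odd-walk j {a} {v} ∣a∣ ∣v∣ t≤jk
      with w , ∣w∣ , a∩w=∅ , ∣w∩v∣ ← neighbour-with-trace (n ∸ ∣ a ∩ v ∣) ∣a∣ ∣v∣ ≤-refl
             (≤-trans (m≤m∸n+n n (∣ a ∩ v ∣)) (+-monoʳ-≤ (n ∸ ∣ a ∩ v ∣) (m≤n+m (∣ a ∩ v ∣) k)))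
      = step ∣w∣ a∩w=∅ (even-walk j ∣w∣ ∣v∣ (begin
          n                        ≤⟨ m≤m∸n+n n (∣ a ∩ v ∣) ⟩
          n ∸ ∣ a ∩ v ∣ + ∣ a ∩ v ∣ ≤⟨ +-monoʳ-≤ (n ∸ ∣ a ∩ v ∣) t≤jk ⟩
          n ∸ ∣ a ∩ v ∣ + j * k     ≡⟨ cong (_+ j * k) ∣w∩v∣ ⟨
          ∣ w ∩ v ∣ + j * k         ∎))
      where open ≤-Reasoning

  module _ .{{_ : NonZero k}} {u v : Subset N} (∣u∣ : ∣ u ∣ ≡ n) (∣v∣ : ∣ v ∣ ≡ n) where

    private
      s : ℕ
      s = ∣ u ∩ v ∣

    odd-distance : (∀ i → n ≤ s + i * k → s + k ≤ i * k) → IsDist N n u v (suc (2 * ⌈ s / k ⌉))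
    odd-distance even-too-long =
      odd-walk ⌈ s / k ⌉ ∣u∣ ∣v∣ (m≤⌈m/n⌉*n s k) , shortest
      where
      shortest : ∀ m → Walk N n u v m → suc (2 * ⌈ s / k ⌉) ≤ m
      shortest m walk with even⊎odd m
      ... | inj₂ (i , refl) =
        s≤s (*-monoʳ-≤ 2 (m≤o*n⇒⌈m/n⌉≤o s k i (odd-walk-bound i ∣u∣ ∣v∣ walk)))
      ... | inj₁ (i , refl) = ⌈s/k⌉<i i (even-too-long i (even-walk-bound i ∣u∣ ∣v∣ walk))
        where
        ⌈s/k⌉<i : ∀ i → s + k ≤ i * k → suc (2 * ⌈ s / k ⌉) ≤ 2 * i
        ⌈s/k⌉<i zero s+k≤0 = contradiction (≤-trans (m≤n+m k s) s+k≤0) (<⇒≱ (>-nonZero⁻¹ k))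
        ⌈s/k⌉<i (suc i) s+k≤k+ik = begin
          suc (2 * ⌈ s / k ⌉)    ≤⟨ n≤1+n _ ⟩
          2 + 2 * ⌈ s / k ⌉      ≡⟨ *-suc 2 ⌈ s / k ⌉ ⟨
          2 * suc ⌈ s / k ⌉      ≤⟨ *-monoʳ-≤ 2 (s≤s (m≤o*n⇒⌈m/n⌉≤o s k i s≤ik)) ⟩
          2 * suc i              ∎
          where
          open ≤-Reasoning
          s≤ik : s ≤ i * k
          s≤ik = +-cancelʳ-≤ k s (i * k) (≤-trans s+k≤k+ik (≤-reflexive (+-comm k (i * k))))

    even-distance : (∀ i → s ≤ i * k → n ≤ s + i * k) → IsDist N n u v (2 * ⌈ (n ∸ s) / k ⌉)
    even-distance odd-too-long =
      even-walk ⌈ (n ∸ s) / k ⌉ ∣u∣ ∣v∣ (≤-trans (m≤n+m∸n n s) (+-monoʳ-≤ s (m≤⌈m/n⌉*n (n ∸ s) k))) ,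
      shortest
      where
      ⌈[n∸s]/k⌉≤i : ∀ i → n ≤ s + i * k → ⌈ (n ∸ s) / k ⌉ ≤ i
      ⌈[n∸s]/k⌉≤i i n≤s+ik = m≤o*n⇒⌈m/n⌉≤o (n ∸ s) k i (m≤n+o⇒m∸n≤o n s n≤s+ik)
      shortest : ∀ m → Walk N n u v m → 2 * ⌈ (n ∸ s) / k ⌉ ≤ m
      shortest m walk with even⊎odd m
      ... | inj₁ (i , refl) = *-monoʳ-≤ 2 (⌈[n∸s]/k⌉≤i i (even-walk-bound i ∣u∣ ∣v∣ walk))
      ... | inj₂ (i , refl) =
        m≤n⇒m≤1+n (*-monoʳ-≤ 2 (⌈[n∸s]/k⌉≤i i (odd-too-long i (odd-walk-bound i ∣u∣ ∣v∣ walk))))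

open import Defs
open import Data.Nat using (ℕ; _+_; _*_; _∸_; NonZero)
open import Data.Integer using (+_; _<_; _>_) renaming (_+_ to _ℤ+_)
open import Data.Fin.Subset using (Subset; ∣_∣; _∩_)
open import Data.Product using (_×_; ∃-syntax; _,_)
open import Relation.Binary.PropositionalEquality using (_≡_; refl)
open Arithmetic using (odd-regime; even-regime)

corollary2 : (n k : ℕ) → .{{_ : NonZero n}} → .{{_ : NonZero k}} →
             (u v : Subset (2 * n + k)) → ∣ u ∣ ≡ n → ∣ v ∣ ≡ n →
             ((+ ∣ u ∩ v ∣ < threshold n k) →
                ∃[ d ] (IsDist (2 * n + k) n u v d × Odd d))
             × ((+ ∣ u ∩ v ∣ > threshold n k ℤ+ + H n k) →
                ∃[ d ] (IsDist (2 * n + k) n u v d × Even d))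
corollary2 n k u v ∣u∣ ∣v∣ =
    (λ s<T → _ , odd-distance ∣u∣ ∣v∣ (odd-regime n k _ s<T) , ⌈ ∣ u ∩ v ∣ / k ⌉ , refl)
  , (λ T+H<s → _ , even-distance ∣u∣ ∣v∣ (even-regime n k _ T+H<s) , ⌈ n ∸ ∣ u ∩ v ∣ / k ⌉ , refl)
  where open KneserGraph n k
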